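{- Let $G$ be a counterexample with the fewest number of vertices to the statement "every graph $G$ with $\mathrm{mad}(G)<\frac52$, $g(G)\geq 10$ and $\Delta(G)=4$ satisfies $\chi^2_l(G)\leq 6$". Then $G$ does not contain any $3^+$-path.
   Context: Graphs are finite and simple. $\mathrm{mad}(G)$ is the maximum of $2|E(H)|/|V(H)|$ over subgraphs $H$ of $G$; $g(G)$ is the girth; $\Delta(G)$ the maximum degree. $\chi^2_l(G)$ is the smallest $k$ such that for every assignment of lists of size at least $k$ to the vertices there is a choice of colors from the lists with vertices at distance at most $2$ receiving different colors. A $d$-vertex ($d^+$-vertex) is a vertex of degree $d$ (at least $d$). A $k$-path ($k^+$-path) is a path of length $k+1$ (at least $k+1$) whose $k$ (at least $k$) internal vertices are $2$-vertices and whose two endvertices are $3^+$-vertices. -}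

module Defs where

open import Data.Nat using (ℕ; zero; suc; _+_; _*_; _≤_; _<_; _<ᵇ_)
open import Data.Bool using (Bool; true; false; _∧_)
open import Data.Fin using (Fin; zero; suc; toℕ; inject₁; fromℕ)
open import Data.List using (List; length; filterᵇ; allFin; cartesianProduct)
open import Data.List.Membership.Propositional using (_∈_)
open import Data.List.Relation.Unary.Unique.Propositional using (Unique)
open import Data.Product using (Σ; ∃; ∃-syntax; _×_; _,_; proj₁; proj₂)
open import Data.Sum using (_⊎_)
open import Function.Definitions using (Injective)
open import Relation.Binary.PropositionalEquality using (_≡_; _≢_)
open import Relation.Nullary using (¬_)

record Graph : Set where
  field
    n      : ℕ
    adj    : Fin n → Fin n → Bool
    sym    : ∀ u v → adj u v ≡ adj v u
    irrefl : ∀ v → adj v v ≡ false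
open Graph public

Adj : (G : Graph) → Fin (n G) → Fin (n G) → Set
Adj G u v = adj G u v ≡ true

∣V∣ : Graph → ℕ
∣V∣ G = n G

deg : (G : Graph) → Fin (n G) → ℕ
deg G v = length (filterᵇ (adj G v) (allFin (n G)))

MaxDegreeIs : Graph → ℕ → Set
MaxDegreeIs G d = (∀ v → deg G v ≤ d) × (∃[ v ] deg G v ≡ d)

record Subgraph (G : Graph) : Set where
  field
    S    : Fin (n G) → Bool
    F    : Fin (n G) → Fin (n G) → Bool
    Fsym : ∀ u v → F u v ≡ F v u
    F⊆   : ∀ u v → F u v ≡ true → (adj G u v ≡ true) × (S u ≡ true) × (S v ≡ true)
open Subgraph public

vH : {G : Graph} → Subgraph G → ℕ
vH {G} H = length (filterᵇ (S H) (allFin (n G)))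

eH : {G : Graph} → Subgraph G → ℕ
eH {G} H = length (filterᵇ (λ p → (toℕ (proj₁ p) <ᵇ toℕ (proj₂ p)) ∧ F H (proj₁ p) (proj₂ p))
                           (cartesianProduct (allFin (n G)) (allFin (n G))))

-- mad(G) < 5/2 : for every subgraph H with |V(H)| > 0, 2|E(H)|/|V(H)| < 5/2,
-- i.e. 4|E(H)| < 5|V(H)|.
MadLt5/2 : Graph → Set
MadLt5/2 G = ∀ (H : Subgraph G) → 0 < vH H → 4 * eH H < 5 * vH H

-- A cycle on suc m distinct vertices c 0, …, c m (length suc m).
Cycle : (G : Graph) → ℕ → Set
Cycle G m = Σ (Fin (suc m) → Fin (n G)) λ c →
    Injective _≡_ _≡_ c
  × (∀ (i : Fin m) → Adj G (c (inject₁ i)) (c (suc i)))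
  × Adj G (c (fromℕ m)) (c zero)

GirthAtLeast : Graph → ℕ → Set
GirthAtLeast G g = ∀ m → 2 ≤ m → suc m < g → ¬ Cycle G m

Dist≤2 : (G : Graph) → Fin (n G) → Fin (n G) → Set
Dist≤2 G u v = Adj G u v ⊎ (∃[ w ] Adj G u w × Adj G w v)

-- 2-distance k-choosability, i.e. χ²_l(G) ≤ k (colours are natural numbers;
-- a list of size ≥ k is a duplicate-free list of length ≥ k).
TwoDistChoosable : Graph → ℕ → Set
TwoDistChoosable G k =
  ∀ (L : Fin (n G) → List ℕ) →
    (∀ v → Unique (L v)) → (∀ v → k ≤ length (L v)) →
    Σ (Fin (n G) → ℕ) λ c → ((∀ v → c v ∈ L v) × (∀ u v → u ≢ v → Dist≤2 G u v → c u ≢ c v))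

Hyp : Graph → Set
Hyp G = MadLt5/2 G × GirthAtLeast G 10 × MaxDegreeIs G 4

MinimalCounterexample : Graph → Set
MinimalCounterexample G =
    Hyp G × ¬ TwoDistChoosable G 6
  × (∀ (G' : Graph) → ∣V∣ G' < ∣V∣ G → Hyp G' → TwoDistChoosable G' 6)

KPath : (G : Graph) → ℕ → Set
KPath G k = Σ (Fin (suc (suc k)) → Fin (n G)) λ p →
    Injective _≡_ _≡_ p
  × (∀ (i : Fin (suc k)) → Adj G (p (inject₁ i)) (p (suc i)))
  × (∀ (i : Fin k) → deg G (p (suc (inject₁ i))) ≡ 2)
  × 3 ≤ deg G (p zero)
  × 3 ≤ deg G (p (fromℕ (suc k)))

HasPlusPath : Graph → ℕ → Set
HasPlusPath G ℓ = ∃[ k ] (ℓ ≤ k × KPath G k)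

-- Three consecutive 2-vertices p₁ p₂ p₃ on a path p₀ p₁ p₂ p₃ p₄ are reducible. Delete p₂: the
-- smaller graph still satisfies the hypotheses (mad and girth only decrease, and Δ = 4 survives
-- because p₂ and its neighbours are 2-vertices), so by minimality it is 2-distance 6-choosable.
-- Extending its colouring to G can only fail at p₂ and at p₁ (p₁ and p₃ are at distance 2
-- in G but not in G - p₂).
-- Recolour p₁ avoiding p₀, p₃ and the at most three other neighbours of p₀ (five colours),
-- then colour p₂ avoiding p₀, p₁, p₃, p₄ (four colours); lists of size 6 leave a choice.

module Submission where

open import Data.Bool using (Bool; true; false; _∧_)
open import Data.Bool.Properties using (T-≡; T?; ∧-zeroʳ)
open import Data.Empty using (⊥)
open import Data.Fin using (Fin; zero; suc; toℕ; punchIn; punchOut; #_) renaming (_≟_ to _≟ᶠ_)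
open import Data.Fin.Properties using (punchIn-injective; punchIn-punchOut)
open import Data.List using (List; []; _∷_; length; filterᵇ; allFin; tabulate; map; _++_; cartesianProduct)
open import Data.List.Membership.Propositional using (_∈_; _∉_; find)
open import Data.List.Membership.Propositional.Properties using (∈-filter⁺; ∈-allFin; ∈-map⁺)
open import Data.List.Properties using (length-++; filter-++; length-map; length-removeAt′)
open import Data.List.Relation.Binary.Subset.Propositional using (_⊆_)
open import Data.List.Relation.Unary.All as All using (All; []; _∷_; all?)
open import Data.List.Relation.Unary.All.Properties using (¬All⇒Any¬)
open import Data.List.Relation.Unary.Any using (here; there; _─_)
open import Data.List.Relation.Unary.Unique.Propositional using (Unique)
open import Data.List.Relation.Unary.Unique.Propositional.Properties using (allFin⁺; filter⁺)
open import Data.List.Relation.Unary.AllPairs using ([]; _∷_)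
open import Data.Nat using (ℕ; zero; suc; _+_; _*_; _≤_; _<_; _<ᵇ_; z≤n; s≤s) renaming (_≟_ to _≟ℕ_)
open import Data.Nat.Properties using (≤-trans; <⇒≱; <⇒≢; n<1+n; n≤1+n; m≤n+m; +-0-commutativeMonoid)
open import Algebra.Properties.CommutativeMonoid.Sum +-0-commutativeMonoid
  using (sum; sum-cong-≗; sum-remove; sum-replicate-zero)
open import Data.Product using (Σ; ∃; ∃-syntax; _×_; _,_; proj₁; proj₂)
open import Data.Sum using (_⊎_; inj₁; inj₂; [_,_])
open import Data.Vec.Functional using (insertAt; updateAt)
open import Data.Vec.Functional.Properties using (insertAt-lookup; insertAt-punchIn; updateAt-updates; updateAt-minimal)
open import Function using (_∘_; id; const; Equivalence)
open import Relation.Binary.Definitions using (DecidableEquality)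
open import Relation.Binary.PropositionalEquality using (_≡_; _≢_; _≗_; refl; sym; trans; cong; cong₂; subst; subst₂; module ≡-Reasoning)
open import Relation.Nullary using (¬_; yes; no; contradiction)

open import Defs hiding (sym)

module _ {A : Set} where

  ∈-─ : ∀ {x z : A} {ys} (x∈ys : x ∈ ys) → z ∈ ys → z ≢ x → z ∈ (ys ─ x∈ys)
  ∈-─ (here refl)  (here refl)  z≢x = contradiction refl z≢x
  ∈-─ (here refl)  (there z∈ys) _   = z∈ys
  ∈-─ (there _)    (here refl)  _   = here refl
  ∈-─ (there x∈ys) (there z∈ys) z≢x = there (∈-─ x∈ys z∈ys z≢x)

  Unique-⊆⇒length≤ : ∀ {xs ys : List A} → Unique xs → xs ⊆ ys → length xs ≤ length ys
  Unique-⊆⇒length≤ {[]}     _            _     = z≤n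
  Unique-⊆⇒length≤ {x ∷ xs} {ys} (x≢xs ∷ xs!) xs⊆ys =
    subst (suc (length xs) ≤_) (sym (length-removeAt′ ys _))
      (s≤s (Unique-⊆⇒length≤ xs! (λ z∈xs → ∈-─ x∈ys (xs⊆ys (there z∈xs)) (≢x z∈xs))))
    where
      x∈ys : x ∈ ys
      x∈ys = xs⊆ys (here refl)
      ≢x : ∀ {z} → z ∈ xs → z ≢ x
      ≢x z∈xs z≡x = All.lookup x≢xs z∈xs (sym z≡x)

module _ {A : Set} (_≟_ : DecidableEquality A) where

  open import Data.List.Membership.DecPropositional _≟_ using (_∈?_)

  longer⇒∃∉ : ∀ {xs ys : List A} → Unique ys → length xs < length ys → ∃[ y ] y ∈ ys × y ∉ xs
  longer⇒∃∉ {xs} {ys} ys! xs<ys with all? (_∈? xs) ys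
  ... | yes ys⊆xs = contradiction (Unique-⊆⇒length≤ ys! (All.lookup ys⊆xs)) (<⇒≱ xs<ys)
  ... | no  ys⊈xs = find (¬All⇒Any¬ (_∈? xs) ys ys⊈xs)

indicator : Bool → ℕ
indicator true  = 1
indicator false = 0

length-filterᵇ-map : ∀ {A B : Set} (f : B → Bool) (h : A → B) xs →
                     length (filterᵇ f (map h xs)) ≡ length (filterᵇ (f ∘ h) xs)
length-filterᵇ-map f h []       = refl
length-filterᵇ-map f h (x ∷ xs) with f (h x)
... | true  = cong suc (length-filterᵇ-map f h xs)
... | false = length-filterᵇ-map f h xs

length-filterᵇ-tabulate : ∀ {A : Set} {k} (f : A → Bool) (g : Fin k → A) →
                          length (filterᵇ f (tabulate g)) ≡ sum (indicator ∘ f ∘ g)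
length-filterᵇ-tabulate {k = zero}  f g = refl
length-filterᵇ-tabulate {k = suc k} f g with f (g zero)
... | true  = cong suc (length-filterᵇ-tabulate f (g ∘ suc))
... | false = length-filterᵇ-tabulate f (g ∘ suc)

length-filterᵇ-cartesianProduct :
  ∀ {A B : Set} {k} (P : A × B → Bool) (g : Fin k → A) ys →
  length (filterᵇ P (cartesianProduct (tabulate g) ys)) ≡ sum (λ i → length (filterᵇ (λ y → P (g i , y)) ys))
length-filterᵇ-cartesianProduct {k = zero}  P g ys = refl
length-filterᵇ-cartesianProduct {k = suc k} P g ys = begin
  length (filterᵇ P (map (g zero ,_) ys ++ rest))
    ≡⟨ cong length (filter-++ (T? ∘ P) (map (g zero ,_) ys) rest) ⟩
  length (filterᵇ P (map (g zero ,_) ys) ++ filterᵇ P rest)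
    ≡⟨ length-++ (filterᵇ P (map (g zero ,_) ys)) ⟩
  length (filterᵇ P (map (g zero ,_) ys)) + length (filterᵇ P rest)
    ≡⟨ cong₂ _+_ (length-filterᵇ-map P (g zero ,_) ys) (length-filterᵇ-cartesianProduct P (g ∘ suc) ys) ⟩
  sum (λ i → length (filterᵇ (λ y → P (g i , y)) ys)) ∎
  where
    open ≡-Reasoning
    rest = cartesianProduct (tabulate (g ∘ suc)) ys

count : ∀ {k} → (Fin k → Bool) → ℕ
count {k} f = length (filterᵇ f (allFin k))

count-punchIn : ∀ {k} (f : Fin (suc k) → Bool) x → count f ≡ indicator (f x) + count (f ∘ punchIn x)
count-punchIn f x = begin
  count f                                            ≡⟨ length-filterᵇ-tabulate f id ⟩
  sum (indicator ∘ f)                                ≡⟨ sum-remove {i = x} (indicator ∘ f) ⟩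
  indicator (f x) + sum (indicator ∘ f ∘ punchIn x)  ≡⟨ cong (indicator (f x) +_) (length-filterᵇ-tabulate (f ∘ punchIn x) id) ⟨
  indicator (f x) + count (f ∘ punchIn x)            ∎
  where open ≡-Reasoning

count-cong : ∀ {k} {f g : Fin k → Bool} → f ≗ g → count f ≡ count g
count-cong {f = f} {g} f≗g = trans (length-filterᵇ-tabulate f id)
  (trans (sum-cong-≗ (cong indicator ∘ f≗g)) (sym (length-filterᵇ-tabulate g id)))

count-none : ∀ {k} (f : Fin k → Bool) → (∀ i → f i ≡ false) → count f ≡ 0
count-none {k} f none = trans (length-filterᵇ-tabulate f id) (trans (sum-cong-≗ (cong indicator ∘ none)) (sum-replicate-zero k))

module _ (G : Graph) where

  Adj-sym : ∀ {u v} → Adj G u v → Adj G v u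
  Adj-sym {u} {v} uv = trans (Graph.sym G v u) uv

  Dist≤2-sym : ∀ {u v} → Dist≤2 G u v → Dist≤2 G v u
  Dist≤2-sym (inj₁ uv)            = inj₁ (Adj-sym uv)
  Dist≤2-sym (inj₂ (w , uw , wv)) = inj₂ (w , Adj-sym wv , Adj-sym uw)

  neighbours : Fin (n G) → List (Fin (n G))
  neighbours q = filterᵇ (adj G q) (allFin (n G))

  ∈-neighbours : ∀ {q v} → Adj G q v → v ∈ neighbours q
  ∈-neighbours {q} {v} qv = ∈-filter⁺ (T? ∘ adj G q) (∈-allFin v) (Equivalence.from T-≡ qv)

  deg≡2⇒neighbours : ∀ {q y z v} → deg G q ≡ 2 → Adj G q y → Adj G q z → y ≢ z →
                     Adj G q v → v ≡ y ⊎ v ≡ z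
  deg≡2⇒neighbours {q} {y} {z} {v} deg≡2 qy qz y≢z qv with v ≟ᶠ y | v ≟ᶠ z
  ... | yes v≡y | _       = inj₁ v≡y
  ... | no _    | yes v≡z = inj₂ v≡z
  ... | no v≢y  | no v≢z  =
    contradiction (subst (3 ≤_) deg≡2 (Unique-⊆⇒length≤ yzv! yzv⊆)) λ { (s≤s (s≤s ())) }
    where
      yzv! : Unique (y ∷ z ∷ v ∷ [])
      yzv! = (y≢z ∷ (v≢y ∘ sym) ∷ []) ∷ ((v≢z ∘ sym) ∷ []) ∷ [] ∷ []
      yzv⊆ : (y ∷ z ∷ v ∷ []) ⊆ neighbours q
      yzv⊆ (here refl)                 = ∈-neighbours qy
      yzv⊆ (there (here refl))         = ∈-neighbours qz
      yzv⊆ (there (there (here refl))) = ∈-neighbours qv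

ProperColouring : (G : Graph) → (Fin (n G) → List ℕ) → (Fin (n G) → ℕ) → Set
ProperColouring G L c = (∀ v → c v ∈ L v) × (∀ u v → u ≢ v → Dist≤2 G u v → c u ≢ c v)

record ProperOutside (G : Graph) (L : Fin (n G) → List ℕ) (X : Fin (n G) → Set) (c : Fin (n G) → ℕ) : Set where
  field
    ∈-lists  : ∀ v → ¬ X v → c v ∈ L v
    separate : ∀ u v → ¬ X u → ¬ X v → u ≢ v → Dist≤2 G u v → c u ≢ c v

module _ {G : Graph} {L : Fin (n G) → List ℕ} where

  ProperOutside-∅⇒Proper : ∀ {c} → ProperOutside G L (λ _ → ⊥) c → ProperColouring G L c
  ProperOutside-∅⇒Proper proper = (λ v → ∈-lists v id) , (λ u v → separate u v id id)
    where open ProperOutside proper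

  recolour : ∀ {X Y c} (v : Fin (n G)) (N : List (Fin (n G))) →
             Unique (L v) → length N < length (L v) →
             (∀ u → X u → u ≡ v ⊎ Y u) →
             (∀ u → u ≢ v → ¬ Y u → Dist≤2 G v u → u ∈ N) →
             ProperOutside G L X c → ∃ (ProperOutside G L Y)
  recolour {X} {Y} {c} v N Lv! N<Lv X⊆v∪Y N-covers proper =
    c′ , record { ∈-lists = ∈-lists′ ; separate = separate′ }
    where
      open ProperOutside proper
      fresh : ∃[ k ] k ∈ L v × k ∉ map c N
      fresh = longer⇒∃∉ _≟ℕ_ Lv! (subst (_< length (L v)) (sym (length-map c N)) N<Lv)
      c′ : Fin (n G) → ℕ
      c′ = updateAt c v (const (proj₁ fresh))
      unchanged : ∀ u → u ≢ v → c′ u ≡ c u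
      unchanged u u≢v = updateAt-minimal u v c u≢v
      outside-X : ∀ u → u ≢ v → ¬ Y u → ¬ X u
      outside-X u u≢v ¬Yu Xu = [ u≢v , ¬Yu ] (X⊆v∪Y u Xu)
      ∈-lists′ : ∀ u → ¬ Y u → c′ u ∈ L u
      ∈-lists′ u ¬Yu with u ≟ᶠ v
      ... | yes refl = subst (_∈ L u) (sym (updateAt-updates u c)) (proj₁ (proj₂ fresh))
      ... | no u≢v   = subst (_∈ L u) (sym (unchanged u u≢v)) (∈-lists u (outside-X u u≢v ¬Yu))
      fresh≢ : ∀ u → u ≢ v → ¬ Y u → Dist≤2 G v u → c′ v ≢ c′ u
      fresh≢ u u≢v ¬Yu vu c′v≡c′u = proj₂ (proj₂ fresh) (subst (_∈ map c N) cu≡k (∈-map⁺ c (N-covers u u≢v ¬Yu vu)))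
        where
          cu≡k : c u ≡ proj₁ fresh
          cu≡k = trans (sym (unchanged u u≢v)) (trans (sym c′v≡c′u) (updateAt-updates v c))
      separate′ : ∀ u w → ¬ Y u → ¬ Y w → u ≢ w → Dist≤2 G u w → c′ u ≢ c′ w
      separate′ u w ¬Yu ¬Yw u≢w uw with u ≟ᶠ v | w ≟ᶠ v
      ... | yes refl | yes refl = contradiction refl u≢w
      ... | yes refl | no w≢v   = fresh≢ w w≢v ¬Yw uw
      ... | no u≢v   | yes refl = fresh≢ u u≢v ¬Yu (Dist≤2-sym G uw) ∘ sym
      ... | no u≢v   | no w≢v   = subst₂ _≢_ (sym (unchanged u u≢v)) (sym (unchanged w w≢v))
        (separate u w (outside-X u u≢v ¬Yu) (outside-X w w≢v ¬Yw) u≢w uw)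

eH-byRows : ∀ {G} (H : Subgraph G) → eH H ≡ sum (λ i → count (λ j → (toℕ i <ᵇ toℕ j) ∧ F H i j))
eH-byRows {G} H = length-filterᵇ-cartesianProduct (λ (i , j) → (toℕ i <ᵇ toℕ j) ∧ F H i j) id (allFin (n G))

punchIn-<ᵇ : ∀ {k} (x : Fin (suc k)) i j → (toℕ (punchIn x i) <ᵇ toℕ (punchIn x j)) ≡ (toℕ i <ᵇ toℕ j)
punchIn-<ᵇ zero    i       j       = refl
punchIn-<ᵇ (suc x) zero    zero    = refl
punchIn-<ᵇ (suc x) zero    (suc j) = refl
punchIn-<ᵇ (suc x) (suc i) zero    = refl
punchIn-<ᵇ (suc x) (suc i) (suc j) = punchIn-<ᵇ x i j

-- Only the distinctness needed to tell apart the two neighbours of each 2-vertex is recorded.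
record Path₂₂₂ (G : Graph) : Set where
  field
    p₀ p₁ p₂ p₃ p₄ : Fin (n G)
    p₀p₁ : Adj G p₀ p₁
    p₁p₂ : Adj G p₁ p₂
    p₂p₃ : Adj G p₂ p₃
    p₃p₄ : Adj G p₃ p₄
    p₀≢p₂ : p₀ ≢ p₂
    p₁≢p₃ : p₁ ≢ p₃
    p₂≢p₄ : p₂ ≢ p₄
    deg-p₁ : deg G p₁ ≡ 2
    deg-p₂ : deg G p₂ ≡ 2
    deg-p₃ : deg G p₃ ≡ 2

KPath⇒Path₂₂₂ : ∀ {G k} → 3 ≤ k → KPath G k → Path₂₂₂ G
KPath⇒Path₂₂₂ {G} {suc (suc (suc k))} (s≤s (s≤s (s≤s _))) (p , p-inj , steps , inner-deg , _) = record
  { p₀ = p (# 0) ; p₁ = p (# 1) ; p₂ = p (# 2) ; p₃ = p (# 3) ; p₄ = p (# 4)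
  ; p₀p₁ = steps (# 0) ; p₁p₂ = steps (# 1) ; p₂p₃ = steps (# 2) ; p₃p₄ = steps (# 3)
  ; p₀≢p₂ = p₀≢p₂ ; p₁≢p₃ = p₁≢p₃ ; p₂≢p₄ = p₂≢p₄
  ; deg-p₁ = inner-deg (# 0) ; deg-p₂ = inner-deg (# 1) ; deg-p₃ = inner-deg (# 2)
  }
  where
    p₀≢p₂ : p (# 0) ≢ p (# 2)
    p₀≢p₂ e with () ← p-inj e
    p₁≢p₃ : p (# 1) ≢ p (# 3)
    p₁≢p₃ e with () ← p-inj e
    p₂≢p₄ : p (# 2) ≢ p (# 4)
    p₂≢p₄ e with () ← p-inj e

-- Deleting a vertex uses punchIn, which needs the vertex set to be literally Fin (suc m);
-- hence the graph is given by its fields.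
module NonemptyGraph (m : ℕ) (a : Fin (suc m) → Fin (suc m) → Bool)
                     (a-sym : ∀ u v → a u v ≡ a v u) (a-irrefl : ∀ v → a v v ≡ false) where

  G : Graph
  G = record { n = suc m ; adj = a ; sym = a-sym ; irrefl = a-irrefl }

  module Deletion (x : Fin (suc m)) where

    ι : Fin m → Fin (suc m)
    ι = punchIn x

    G∖x : Graph
    G∖x = record { n = m ; adj = λ u v → a (ι u) (ι v) ; sym = λ u v → a-sym (ι u) (ι v) ; irrefl = a-irrefl ∘ ι }

    data View : Fin (suc m) → Set where
      deleted : View x
      kept    : ∀ u → View (ι u)

    view : ∀ v → View v
    view v with x ≟ᶠ v
    ... | yes refl = deleted
    ... | no  x≢v  = subst View (punchIn-punchOut x≢v) (kept (punchOut x≢v))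

    deg-ι : ∀ u → deg G (ι u) ≡ indicator (a (ι u) x) + deg G∖x u
    deg-ι u = count-punchIn (a (ι u)) x

    maxDegree-delete : ∀ {d} → MaxDegreeIs G d → (∀ v → v ≡ x ⊎ Adj G x v → deg G v < d) → MaxDegreeIs G∖x d
    maxDegree-delete {d} (deg≤d , w , deg-w≡d) near-x-small = deg∖x≤d , kept-witness w deg-w≡d
      where
        deg∖x≤d : ∀ u → deg G∖x u ≤ d
        deg∖x≤d u = ≤-trans (m≤n+m _ _) (subst (_≤ d) (deg-ι u) (deg≤d (ι u)))
        kept-witness : ∀ w → deg G w ≡ d → ∃[ u ] deg G∖x u ≡ d
        kept-witness w deg≡d with view w
        ... | deleted = contradiction deg≡d (<⇒≢ (near-x-small x (inj₁ refl)))
        ... | kept u with a (ι u) x in ux | deg-ι u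
        ... | true  | _       = contradiction deg≡d (<⇒≢ (near-x-small (ι u) (inj₂ (Adj-sym G ux))))
        ... | false | deg-ιu  = u , trans (sym deg-ιu) deg≡d

    girth-delete : ∀ {g} → GirthAtLeast G g → GirthAtLeast G∖x g
    girth-delete girth ℓ 2≤ℓ ℓ<g (c , c-inj , steps , closing) =
      girth ℓ 2≤ℓ ℓ<g (ι ∘ c , c-inj ∘ punchIn-injective x _ _ , steps , closing)

    module LiftSubgraph (H : Subgraph G∖x) where

      S′ : Fin (suc m) → Bool
      S′ = insertAt (S H) x false

      F′ : Fin (suc m) → Fin (suc m) → Bool
      F′ = insertAt (λ u → insertAt (F H u) x false) x (const false)

      F′-x· : ∀ v → F′ x v ≡ false
      F′-x· v = cong (λ row → row v) (insertAt-lookup _ x (const false))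

      F′-ι· : ∀ u v → F′ (ι u) v ≡ insertAt (F H u) x false v
      F′-ι· u v = cong (λ row → row v) (insertAt-punchIn _ x (const false) u)

      F′-·x : ∀ v → F′ v x ≡ false
      F′-·x v with view v
      ... | deleted = F′-x· x
      ... | kept u  = trans (F′-ι· u x) (insertAt-lookup (F H u) x false)

      F′-ιι : ∀ u v → F′ (ι u) (ι v) ≡ F H u v
      F′-ιι u v = trans (F′-ι· u (ι v)) (insertAt-punchIn (F H u) x false v)

      F′-sym : ∀ u v → F′ u v ≡ F′ v u
      F′-sym u v with view u | view v
      ... | deleted | _       = trans (F′-x· v) (sym (F′-·x v))
      ... | kept u  | deleted = trans (F′-·x (ι u)) (sym (F′-x· (ι u)))
      ... | kept u  | kept v  = trans (F′-ιι u v) (trans (Fsym H u v) (sym (F′-ιι v u)))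

      F′⊆ : ∀ u v → F′ u v ≡ true → Adj G u v × S′ u ≡ true × S′ v ≡ true
      F′⊆ u v uv with view u | view v
      ... | deleted | _       with () ← trans (sym uv) (F′-x· v)
      ... | kept u  | deleted with () ← trans (sym uv) (F′-·x (ι u))
      ... | kept u  | kept v  with F⊆ H u v (trans (sym (F′-ιι u v)) uv)
      ...   | adj-uv , Su , Sv = adj-uv , trans (insertAt-punchIn (S H) x false u) Su
                                        , trans (insertAt-punchIn (S H) x false v) Sv

      H′ : Subgraph G
      H′ = record { S = S′ ; F = F′ ; Fsym = F′-sym ; F⊆ = F′⊆ }

      vH-lift : vH H′ ≡ vH H
      vH-lift = begin
        count S′                                      ≡⟨ count-punchIn S′ x ⟩
        indicator (S′ x) + count (S′ ∘ ι)             ≡⟨ cong₂ _+_ (cong indicator (insertAt-lookup (S H) x false))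
                                                                   (count-cong (insertAt-punchIn (S H) x false)) ⟩
        count (S H)                                   ∎
        where open ≡-Reasoning

      row′ : Fin (suc m) → ℕ
      row′ i = count (λ j → (toℕ i <ᵇ toℕ j) ∧ F′ i j)

      row′-x : row′ x ≡ 0
      row′-x = count-none (λ j → (toℕ x <ᵇ toℕ j) ∧ F′ x j) (λ j → trans (cong (_ ∧_) (F′-x· j)) (∧-zeroʳ _))

      row′-ι : ∀ i → row′ (ι i) ≡ count (λ j → (toℕ i <ᵇ toℕ j) ∧ F H i j)
      row′-ι i = trans (count-punchIn (λ j → (toℕ (ι i) <ᵇ toℕ j) ∧ F′ (ι i) j) x) (cong₂ _+_
        (cong indicator (trans (cong (_ ∧_) (F′-·x (ι i))) (∧-zeroʳ _)))
        (count-cong (λ j → cong₂ _∧_ (punchIn-<ᵇ x i j) (F′-ιι i j))))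

      eH-lift : eH H′ ≡ eH H
      eH-lift = begin
        eH H′                            ≡⟨ eH-byRows H′ ⟩
        sum row′                         ≡⟨ sum-remove {i = x} row′ ⟩
        row′ x + sum (row′ ∘ ι)          ≡⟨ cong₂ _+_ row′-x (sum-cong-≗ row′-ι) ⟩
        sum (λ i → count (λ j → (toℕ i <ᵇ toℕ j) ∧ F H i j)) ≡⟨ eH-byRows H ⟨
        eH H                             ∎
        where open ≡-Reasoning

    mad-delete : MadLt5/2 G → MadLt5/2 G∖x
    mad-delete mad H 0<vH = subst₂ (λ e v → 4 * e < 5 * v) eH-lift vH-lift
      (mad H′ (subst (0 <_) (sym vH-lift) 0<vH))
      where open LiftSubgraph H

    Dist≤2-delete : ∀ {u v} → Dist≤2 G (ι u) (ι v) → Dist≤2 G∖x u v ⊎ (Adj G (ι u) x × Adj G x (ι v))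
    Dist≤2-delete (inj₁ uv) = inj₁ (inj₁ uv)
    Dist≤2-delete (inj₂ (w , uw , wv)) with view w
    ... | deleted = inj₂ (uw , wv)
    ... | kept w  = inj₁ (inj₂ (w , uw , wv))

    -- Only pairs of neighbours of x come to distance 2 through x, so a colouring of G∖x (x coloured
    -- arbitrarily) stays proper outside any X ∋ x containing all but one neighbour of x.
    insertAt-ProperOutside : ∀ {L X c} → ProperColouring G∖x (L ∘ ι) c → X x →
      (∀ u w → ¬ X u → ¬ X w → Adj G u x → Adj G x w → u ≡ w) →
      ProperOutside G L X (insertAt c x 0)
    insertAt-ProperOutside {L} {X} {c} (c∈L , c-separates) Xx meets =
      record { ∈-lists = ∈-lists ; separate = separate }
      where
        ∈-lists : ∀ v → ¬ X v → insertAt c x 0 v ∈ L v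
        ∈-lists v ¬Xv with view v
        ... | deleted = contradiction Xx ¬Xv
        ... | kept u  = subst (_∈ L (ι u)) (sym (insertAt-punchIn c x 0 u)) (c∈L u)
        separate : ∀ u w → ¬ X u → ¬ X w → u ≢ w → Dist≤2 G u w → insertAt c x 0 u ≢ insertAt c x 0 w
        separate u w ¬Xu ¬Xw u≢w uw with view u | view w
        ... | deleted | _       = contradiction Xx ¬Xu
        ... | kept _  | deleted = contradiction Xx ¬Xw
        ... | kept u  | kept w  with Dist≤2-delete uw
        ...   | inj₁ uw∖x       = subst₂ _≢_ (sym (insertAt-punchIn c x 0 u)) (sym (insertAt-punchIn c x 0 w))
                                    (c-separates u w (u≢w ∘ cong ι) uw∖x)
        ...   | inj₂ (ux , xw)  = contradiction (meets (ι u) (ι w) ¬Xu ¬Xw ux xw) u≢w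

    Hyp-delete : Hyp G → (∀ v → v ≡ x ⊎ Adj G x v → deg G v < 4) → Hyp G∖x
    Hyp-delete (mad , girth , Δ≡4) near-x-small =
      mad-delete mad , girth-delete girth , maxDegree-delete Δ≡4 near-x-small

  module Reduction (P : Path₂₂₂ G) where

    open Path₂₂₂ P
    open Deletion p₂

    neighbours-p₁ : ∀ {v} → Adj G p₁ v → v ≡ p₀ ⊎ v ≡ p₂
    neighbours-p₁ = deg≡2⇒neighbours G deg-p₁ (Adj-sym G p₀p₁) p₁p₂ p₀≢p₂

    neighbours-p₂ : ∀ {v} → Adj G p₂ v → v ≡ p₁ ⊎ v ≡ p₃
    neighbours-p₂ = deg≡2⇒neighbours G deg-p₂ (Adj-sym G p₁p₂) p₂p₃ p₁≢p₃

    neighbours-p₃ : ∀ {v} → Adj G p₃ v → v ≡ p₂ ⊎ v ≡ p₄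
    neighbours-p₃ = deg≡2⇒neighbours G deg-p₃ (Adj-sym G p₂p₃) p₃p₄ p₂≢p₄

    near-p₂-small : ∀ v → v ≡ p₂ ⊎ Adj G p₂ v → deg G v < 4
    near-p₂-small v v≈p₂ = subst (_< 4) (sym (deg-v≡2 v≈p₂)) (s≤s (s≤s (s≤s z≤n)))
      where
        deg-v≡2 : v ≡ p₂ ⊎ Adj G p₂ v → deg G v ≡ 2
        deg-v≡2 (inj₁ refl) = deg-p₂
        deg-v≡2 (inj₂ p₂v) with neighbours-p₂ p₂v
        ... | inj₁ refl = deg-p₁
        ... | inj₂ refl = deg-p₃

    neighbours-p₂∖p₁-equal : ∀ u w → ¬ (u ≡ p₁ ⊎ u ≡ p₂) → ¬ (w ≡ p₁ ⊎ w ≡ p₂) →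
                             Adj G u p₂ → Adj G p₂ w → u ≡ w
    neighbours-p₂∖p₁-equal u w u∉ w∉ up₂ p₂w with neighbours-p₂ (Adj-sym G up₂) | neighbours-p₂ p₂w
    ... | inj₁ u≡p₁ | _         = contradiction (inj₁ u≡p₁) u∉
    ... | _         | inj₁ w≡p₁ = contradiction (inj₁ w≡p₁) w∉
    ... | inj₂ u≡p₃ | inj₂ w≡p₃ = trans u≡p₃ (sym w≡p₃)

    p₀∋p₁ : p₁ ∈ neighbours G p₀
    p₀∋p₁ = ∈-neighbours G p₀p₁

    N₁ : List (Fin (suc m))
    N₁ = p₀ ∷ p₃ ∷ (neighbours G p₀ ─ p₀∋p₁)

    length-N₁≤5 : deg G p₀ ≤ 4 → length N₁ ≤ 5
    length-N₁≤5 deg-p₀≤4 = s≤s (subst (_≤ 4) (length-removeAt′ (neighbours G p₀) _) deg-p₀≤4)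

    N₁-covers-p₁ : ∀ u → u ≢ p₁ → u ≢ p₂ → Dist≤2 G p₁ u → u ∈ N₁
    N₁-covers-p₁ u u≢p₁ u≢p₂ (inj₁ p₁u) with neighbours-p₁ p₁u
    ... | inj₁ refl = here refl
    ... | inj₂ u≡p₂ = contradiction u≡p₂ u≢p₂
    N₁-covers-p₁ u u≢p₁ u≢p₂ (inj₂ (w , p₁w , wu)) with neighbours-p₁ p₁w
    ... | inj₁ refl = there (there (∈-─ p₀∋p₁ (∈-neighbours G wu) u≢p₁))
    ... | inj₂ refl with neighbours-p₂ wu
    ...   | inj₁ u≡p₁ = contradiction u≡p₁ u≢p₁
    ...   | inj₂ refl = there (here refl)

    N₂ : List (Fin (suc m))
    N₂ = p₀ ∷ p₁ ∷ p₃ ∷ p₄ ∷ []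

    N₂-covers-p₂ : ∀ u → u ≢ p₂ → ¬ ⊥ → Dist≤2 G p₂ u → u ∈ N₂
    N₂-covers-p₂ u u≢p₂ _ (inj₁ p₂u) with neighbours-p₂ p₂u
    ... | inj₁ refl = there (here refl)
    ... | inj₂ refl = there (there (here refl))
    N₂-covers-p₂ u u≢p₂ _ (inj₂ (w , p₂w , wu)) with neighbours-p₂ p₂w
    ... | inj₁ refl with neighbours-p₁ wu
    ...   | inj₁ refl = here refl
    ...   | inj₂ u≡p₂ = contradiction u≡p₂ u≢p₂
    N₂-covers-p₂ u u≢p₂ _ (inj₂ (w , p₂w , wu)) | inj₂ refl with neighbours-p₃ wu
    ...   | inj₁ u≡p₂ = contradiction u≡p₂ u≢p₂
    ...   | inj₂ refl = there (there (there (here refl)))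

    extend : deg G p₀ ≤ 4 → TwoDistChoosable G∖x 6 → TwoDistChoosable G 6
    extend deg-p₀≤4 choose L L! 6≤L = proj₁ stage₂ , ProperOutside-∅⇒Proper (proj₂ stage₂)
      where
        c∖x : Σ (Fin m → ℕ) (ProperColouring G∖x (L ∘ ι))
        c∖x = choose (L ∘ ι) (L! ∘ ι) (6≤L ∘ ι)

        stage₀ : ProperOutside G L (λ v → v ≡ p₁ ⊎ v ≡ p₂) (insertAt (proj₁ c∖x) p₂ 0)
        stage₀ = insertAt-ProperOutside (proj₂ c∖x) (inj₂ refl) neighbours-p₂∖p₁-equal

        stage₁ : ∃ (ProperOutside G L (_≡ p₂))
        stage₁ = recolour p₁ N₁ (L! p₁) (≤-trans (s≤s (length-N₁≤5 deg-p₀≤4)) (6≤L p₁))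
                   (λ _ → id) N₁-covers-p₁ stage₀

        stage₂ : ∃ (ProperOutside G L (λ _ → ⊥))
        stage₂ = recolour p₂ N₂ (L! p₂) (≤-trans (n≤1+n 5) (6≤L p₂))
                   (λ _ → inj₁) N₂-covers-p₂ (proj₂ stage₁)

    ¬minimal : ¬ MinimalCounterexample G
    ¬minimal (hyp@(_ , _ , Δ≤4 , _) , ¬choosable , minimal) =
      ¬choosable (extend (Δ≤4 p₀) (minimal G∖x (n<1+n m) (Hyp-delete hyp near-p₂-small)))

¬MinimalCounterexample-with-Path₂₂₂ : (G : Graph) → MinimalCounterexample G → ¬ Path₂₂₂ G
¬MinimalCounterexample-with-Path₂₂₂ record { n = zero } _ P with () ← Path₂₂₂.p₀ P
¬MinimalCounterexample-with-Path₂₂₂ record { n = suc m ; adj = a ; sym = a-sym ; irrefl = a-irrefl } counterexample P =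
  NonemptyGraph.Reduction.¬minimal m a a-sym a-irrefl P counterexample

lemma12 : (G : Graph) → MinimalCounterexample G → ¬ HasPlusPath G 3
lemma12 G counterexample (k , 3≤k , path) =
  ¬MinimalCounterexample-with-Path₂₂₂ G counterexample (KPath⇒Path₂₂₂ 3≤k path)
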